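{- Suppose that there exist two vertices $b_i$ and $b_j$ in $D'$ such that $N_G[b_i] = N_G[b_j]$. Then, $(G,l,I_{\mathrm{ini}},s)$ is a yes-instance if and only if $(G \setminus \{b_i\},l,I_{\mathrm{ini}},s)$ is.
   Context: For an integer $l \ge 0$, two independent sets $I_p, I_q$ of a graph $G$ with $|I_p|, |I_q| \ge l$ are reachable under the $\mathsf{TAR}(l)$ rule if there is a sequence $\langle I_1, \ldots, I_\ell \rangle$ of independent sets of $G$ with $I_1 = I_p$, $I_\ell = I_q$, $|I_i| \ge l$ for all $i$, and $|I_i \triangle I_{i+1}| = 1$ for all $i$. Opt-ISR parameterized by solution size $s$: given an instance $(G, l, I_{\mathrm{ini}}, s)$, decide whether $G$ has an independent set $I$ with $|I| \ge s$ reachable from $I_{\mathrm{ini}}$ under the $\mathsf{TAR}(l)$ rule. Let $(G,l,I_{\mathrm{ini}},s)$ be such an instance where $G$ is $d$-degenerate and $|I_{\mathrm{ini}}| < s$. Let $D$ be the set of vertices of $G$ of degree at most $2d$ and $D' = D \setminus I_{\mathrm{ini}}$. $N_G[v]$ denotes the closed neighborhood of $v$, and $G \setminus \{b_i\}$ is the graph obtained by deleting $b_i$. -}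

module Defs where

open import Data.Bool using (Bool; true; false)
open import Data.Nat using (ℕ; suc; _≤_)
open import Data.Fin using (Fin; punchIn)
open import Data.Fin.Subset using (Subset; _∈_; _∉_; _∪_; _∩_; _─_; ∣_∣; ⁅_⁆; Nonempty)
open import Data.Vec using (tabulate; lookup)
open import Data.Product using (Σ; ∃; _×_)
open import Relation.Binary.PropositionalEquality using (_≡_)

record Graph (n : ℕ) : Set where
  field
    adj    : Fin n → Fin n → Bool
    sym    : ∀ u v → adj u v ≡ adj v u
    irrefl : ∀ v → adj v v ≡ false
open Graph public

module _ {n : ℕ} (G : Graph n) where

  N : Fin n → Subset n
  N v = tabulate (adj G v)

  N[_] : Fin n → Subset n
  N[ v ] = N v ∪ ⁅ v ⁆

  degree : Fin n → ℕ
  degree v = ∣ N v ∣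

  Degenerate : ℕ → Set
  Degenerate d = ∀ (S : Subset n) → Nonempty S →
    Σ (Fin n) λ v → v ∈ S × ∣ N v ∩ S ∣ ≤ d

  IsIndependent : Subset n → Set
  IsIndependent I = ∀ u v → u ∈ I → v ∈ I → adj G u v ≡ false

  InD' : ℕ → Subset n → Fin n → Set
  InD' d Iini v = degree v ≤ 2 Data.Nat.* d × v ∉ Iini

  _△_ : Subset n → Subset n → Subset n
  I △ J = (I ─ J) ∪ (J ─ I)

  data Reach (l : ℕ) : Subset n → Subset n → Set where
    here : ∀ {I} → IsIndependent I → l ≤ ∣ I ∣ → Reach l I I
    step : ∀ {I J K} → IsIndependent I → l ≤ ∣ I ∣ →
           ∣ I △ J ∣ ≡ 1 → Reach l J K → Reach l I K

  YesInstance : ℕ → Subset n → ℕ → Set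
  YesInstance l Iini s = ∃ λ (I : Subset n) → s ≤ ∣ I ∣ × Reach l Iini I

-- G \ {b}: delete vertex b; the remaining vertices are relabelled by punchIn b.
delete : ∀ {m} → Graph (suc m) → Fin (suc m) → Graph m
delete G b = record
  { adj    = λ u v → adj G (punchIn b u) (punchIn b v)
  ; sym    = λ u v → sym G (punchIn b u) (punchIn b v)
  ; irrefl = λ v → irrefl G (punchIn b v)
  }

restrict : ∀ {m} → Fin (suc m) → Subset (suc m) → Subset m
restrict b I = tabulate (λ v → lookup I (punchIn b v))

-- Adjacent twins bi, bj never lie together in an independent set. Replacing bi by bj in
-- every set containing it maps each TAR(l) sequence of G to one avoiding bi, i.e. to a
-- sequence of G \ {bi}: it keeps sets independent and their sizes and, being linear over
-- GF(2), turns single-vertex steps into single-vertex steps. Conversely a sequence of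
-- G \ {bi} is one of G. As bi ∉ I_ini both instances start from the same set.
module Submission where

open import Defs hiding (sym)
open import Data.Nat using (ℕ; suc; _<_; _≤_)
import Data.Nat.Properties as ℕ
open import Data.Bool using (true; false; _∧_; _∨_; _xor_)
open import Data.Bool.Properties
  using (∨-identityʳ; ∧-identityʳ; ∧-zeroʳ; xor-identityʳ; xor-same; xor-assoc; ∧-distribʳ-xor; xor-∧-commutativeRing)
open import Data.Fin using (Fin; zero; suc; punchIn; punchOut)
open import Data.Fin.Properties using (_≟_; suc-injective; punchIn-punchOut)
open import Data.Fin.Subset using (Subset; _∈_; _∉_; _─_; _∪_; ∣_∣; ⁅_⁆; ⊥)
open import Data.Fin.Subset.Properties using (_∈?_; x∈⁅x⁆; x≢y⇒x∉⁅y⁆; ∣⁅x⁆∣≡1)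
open import Data.Vec using ([]; _∷_; lookup; tabulate; insertAt; _[_]≔_)
open import Data.Vec.Properties
  using (lookup∘tabulate; tabulate∘lookup; tabulate-cong; lookup-zipWith; []=⇒lookup; lookup⇒[]=;
         insertAt-lookup; insertAt-punchIn; lookup∘update; lookup∘update′)
open import Data.Product using (∃; _×_; _,_)
open import Data.Sum using (_⊎_; inj₁; inj₂)
open import Function using (_∘_)
open import Function.Bundles using (_⇔_; mk⇔)
open import Relation.Nullary using (yes; no; contradiction)
open import Relation.Binary.PropositionalEquality
  using (_≡_; _≢_; _≗_; refl; sym; trans; cong; cong₂; subst; module ≡-Reasoning)
open import Algebra.Bundles using (CommutativeRing)
open import Algebra.Properties.CommutativeSemigroup
  (CommutativeRing.+-commutativeSemigroup xor-∧-commutativeRing) using (interchange)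

open ≡-Reasoning

private
  variable
    n m : ℕ

lookup-ext : {X Y : Subset n} → lookup X ≗ lookup Y → X ≡ Y
lookup-ext {X = X} {Y} X≗Y = trans (sym (tabulate∘lookup X)) (trans (tabulate-cong X≗Y) (tabulate∘lookup Y))

∉⇒lookup≡false : {x : Fin n} {X : Subset n} → x ∉ X → lookup X x ≡ false
∉⇒lookup≡false {x = x} {X} x∉X with lookup X x in eq
... | false = refl
... | true  = contradiction (lookup⇒[]= x X eq) x∉X

lookup-⁅x⁆ : (x : Fin n) → lookup ⁅ x ⁆ x ≡ true
lookup-⁅x⁆ x = []=⇒lookup (x∈⁅x⁆ x)

lookup-⁅y⁆ : {x y : Fin n} → x ≢ y → lookup ⁅ y ⁆ x ≡ false
lookup-⁅y⁆ = ∉⇒lookup≡false ∘ x≢y⇒x∉⁅y⁆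

lookup-restrict : (b : Fin (suc m)) (X : Subset (suc m)) (v : Fin m) →
                  lookup (restrict b X) v ≡ lookup X (punchIn b v)
lookup-restrict b X = lookup∘tabulate (lookup X ∘ punchIn b)

xor≡true : ∀ x y → x xor y ≡ true → x ≡ true ⊎ y ≡ true
xor≡true true  _    _  = inj₁ refl
xor≡true false true _  = inj₂ refl

∣p∣≡0⇒p≡⊥ : (X : Subset n) → ∣ X ∣ ≡ 0 → X ≡ ⊥
∣p∣≡0⇒p≡⊥ []          _      = refl
∣p∣≡0⇒p≡⊥ (true ∷ X)  ()
∣p∣≡0⇒p≡⊥ (false ∷ X) ∣X∣≡0 = cong (false ∷_) (∣p∣≡0⇒p≡⊥ X ∣X∣≡0)

∣p∣≡1⇒p≡⁅x⁆ : (X : Subset n) → ∣ X ∣ ≡ 1 → ∃ λ x → X ≡ ⁅ x ⁆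
∣p∣≡1⇒p≡⁅x⁆ (true ∷ X)  ∣X∣+1≡1 = zero , cong (true ∷_) (∣p∣≡0⇒p≡⊥ X (ℕ.suc-injective ∣X∣+1≡1))
∣p∣≡1⇒p≡⁅x⁆ (false ∷ X) ∣X∣≡1 with ∣p∣≡1⇒p≡⁅x⁆ X ∣X∣≡1
... | x , X≡⁅x⁆ = suc x , cong (false ∷_) X≡⁅x⁆

∣p∣≡suc∣q∣ : (X Y : Subset n) (w : Fin n) → lookup X w ≡ true → lookup Y w ≡ false →
             (∀ v → v ≢ w → lookup X v ≡ lookup Y v) → ∣ X ∣ ≡ suc ∣ Y ∣
∣p∣≡suc∣q∣ (true ∷ X) (false ∷ Y) zero refl refl agree =
  cong (suc ∘ ∣_∣) (lookup-ext {X = X} {Y} λ v → agree (suc v) λ ())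
∣p∣≡suc∣q∣ (true ∷ X) (true ∷ Y) (suc w) X[w] Y[w] agree =
  cong suc (∣p∣≡suc∣q∣ X Y w X[w] Y[w] λ v v≢w → agree (suc v) (v≢w ∘ suc-injective))
∣p∣≡suc∣q∣ (false ∷ X) (false ∷ Y) (suc w) X[w] Y[w] agree =
  ∣p∣≡suc∣q∣ X Y w X[w] Y[w] λ v v≢w → agree (suc v) (v≢w ∘ suc-injective)
∣p∣≡suc∣q∣ (true ∷ X) (false ∷ Y) (suc w) _ _ agree = contradiction (agree zero λ ()) λ ()
∣p∣≡suc∣q∣ (false ∷ X) (true ∷ Y) (suc w) _ _ agree = contradiction (agree zero λ ()) λ ()

∣restrict∣ : (b : Fin (suc m)) (X : Subset (suc m)) → lookup X b ≡ false → ∣ restrict b X ∣ ≡ ∣ X ∣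
∣restrict∣ zero (false ∷ X) refl = cong ∣_∣ (tabulate∘lookup X)
∣restrict∣ {suc m} (suc b) (true ∷ X) X[b] = cong suc (∣restrict∣ b X X[b])
∣restrict∣ {suc m} (suc b) (false ∷ X) X[b] = ∣restrict∣ b X X[b]

-- The statements below spell out _△_ G of Defs, which does not depend on G.

lookup-△ : (X Y : Subset n) (v : Fin n) → lookup ((X ─ Y) ∪ (Y ─ X)) v ≡ lookup X v xor lookup Y v
lookup-△ (true ∷ X)  (true ∷ Y)  zero    = refl
lookup-△ (true ∷ X)  (false ∷ Y) zero    = refl
lookup-△ (false ∷ X) (true ∷ Y)  zero    = refl
lookup-△ (false ∷ X) (false ∷ Y) zero    = refl
lookup-△ (_ ∷ X)     (_ ∷ Y)     (suc v) = lookup-△ X Y v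

punchIn-cover : (b v : Fin (suc m)) → v ≡ b ⊎ ∃ λ v′ → punchIn b v′ ≡ v
punchIn-cover b v with v ≟ b
... | yes v≡b = inj₁ v≡b
... | no  v≢b = inj₂ (punchOut (v≢b ∘ sym) , punchIn-punchOut (v≢b ∘ sym))

module _ (b : Fin (suc m)) where

  restrict-△ : (X Y : Subset (suc m)) →
               restrict b ((X ─ Y) ∪ (Y ─ X)) ≡ (restrict b X ─ restrict b Y) ∪ (restrict b Y ─ restrict b X)
  restrict-△ X Y = lookup-ext λ v → begin
    lookup (restrict b ((X ─ Y) ∪ (Y ─ X))) v          ≡⟨ lookup-restrict b ((X ─ Y) ∪ (Y ─ X)) v ⟩
    lookup ((X ─ Y) ∪ (Y ─ X)) (punchIn b v)          ≡⟨ lookup-△ X Y (punchIn b v) ⟩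
    lookup X (punchIn b v) xor lookup Y (punchIn b v) ≡⟨ sym (cong₂ _xor_ (lookup-restrict b X v) (lookup-restrict b Y v)) ⟩
    lookup (restrict b X) v xor lookup (restrict b Y) v ≡⟨ sym (lookup-△ (restrict b X) (restrict b Y) v) ⟩
    lookup ((restrict b X ─ restrict b Y) ∪ (restrict b Y ─ restrict b X)) v ∎

  ∣restrict-△∣ : (X Y : Subset (suc m)) → lookup X b ≡ lookup Y b →
                 ∣ (restrict b X ─ restrict b Y) ∪ (restrict b Y ─ restrict b X) ∣ ≡ ∣ (X ─ Y) ∪ (Y ─ X) ∣
  ∣restrict-△∣ X Y X[b]≡Y[b] = begin
    ∣ (restrict b X ─ restrict b Y) ∪ (restrict b Y ─ restrict b X) ∣ ≡⟨ cong ∣_∣ (sym (restrict-△ X Y)) ⟩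
    ∣ restrict b ((X ─ Y) ∪ (Y ─ X)) ∣                                ≡⟨ ∣restrict∣ b ((X ─ Y) ∪ (Y ─ X)) X△Y[b]≡false ⟩
    ∣ (X ─ Y) ∪ (Y ─ X) ∣                                            ∎
    where
    X△Y[b]≡false : lookup ((X ─ Y) ∪ (Y ─ X)) b ≡ false
    X△Y[b]≡false = trans (lookup-△ X Y b) (trans (cong (_xor lookup Y b) X[b]≡Y[b]) (xor-same (lookup Y b)))

  restrict-insertAt : (X : Subset m) → restrict b (insertAt X b false) ≡ X
  restrict-insertAt X = lookup-ext λ v → trans (lookup-restrict b (insertAt X b false) v) (insertAt-punchIn X b false v)

  insertAt-restrict : {Y : Subset (suc m)} → lookup Y b ≡ false → insertAt (restrict b Y) b false ≡ Y
  insertAt-restrict {Y} Y[b] = lookup-ext λ v → at v (punchIn-cover b v)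
    where
    at : ∀ v → v ≡ b ⊎ ∃ (λ v′ → punchIn b v′ ≡ v) → lookup (insertAt (restrict b Y) b false) v ≡ lookup Y v
    at v (inj₁ refl)         = trans (insertAt-lookup (restrict b Y) b false) (sym Y[b])
    at v (inj₂ (v′ , refl)) = trans (insertAt-punchIn (restrict b Y) b false v′) (lookup-restrict b Y v′)

  ∣insertAt∣ : (X : Subset m) → ∣ insertAt X b false ∣ ≡ ∣ X ∣
  ∣insertAt∣ X = trans (sym (∣restrict∣ b (insertAt X b false) (insertAt-lookup X b false)))
                       (cong ∣_∣ (restrict-insertAt X))

  ∣insertAt-△∣ : (X Y : Subset m) →
                 ∣ (insertAt X b false ─ insertAt Y b false) ∪ (insertAt Y b false ─ insertAt X b false) ∣ ≡ ∣ (X ─ Y) ∪ (Y ─ X) ∣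
  ∣insertAt-△∣ X Y = trans
    (sym (∣restrict-△∣ (insertAt X b false) (insertAt Y b false)
                       (trans (insertAt-lookup X b false) (sym (insertAt-lookup Y b false)))))
    (cong₂ (λ X′ Y′ → ∣ (X′ ─ Y′) ∪ (Y′ ─ X′) ∣) (restrict-insertAt X) (restrict-insertAt Y))

  ∈-insertAt : {X : Subset m} {u : Fin (suc m)} → u ∈ insertAt X b false → ∃ λ u′ → punchIn b u′ ≡ u × u′ ∈ X
  ∈-insertAt {X} {u} u∈ with punchIn-cover b u
  ... | inj₁ refl = contradiction (trans (sym ([]=⇒lookup u∈)) (insertAt-lookup X b false)) λ ()
  ... | inj₂ (u′ , refl) =
    u′ , refl , lookup⇒[]= u′ X (trans (sym (insertAt-punchIn X b false u′)) ([]=⇒lookup u∈))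

  module _ (G : Graph (suc m)) where

    restrict-independent : {I : Subset (suc m)} → IsIndependent G I → IsIndependent (delete G b) (restrict b I)
    restrict-independent {I} I-ind u v u∈ v∈ = I-ind (punchIn b u) (punchIn b v) (punched u∈) (punched v∈)
      where
      punched : ∀ {u} → u ∈ restrict b I → punchIn b u ∈ I
      punched {u} u∈ = lookup⇒[]= _ I (trans (sym (lookup-restrict b I u)) ([]=⇒lookup u∈))

    insertAt-independent : {X : Subset m} → IsIndependent (delete G b) X → IsIndependent G (insertAt X b false)
    insertAt-independent X-ind u v u∈ v∈ with ∈-insertAt u∈ | ∈-insertAt v∈
    ... | u′ , refl , u′∈X | v′ , refl , v′∈X = X-ind u′ v′ u′∈X v′∈X

record ReconfigurationMap (G : Graph n) (G′ : Graph m) (F : Subset n → Subset m) : Set where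
  field
    independent : {I : Subset n} → IsIndependent G I → IsIndependent G′ (F I)
    size        : {I : Subset n} → IsIndependent G I → ∣ F I ∣ ≡ ∣ I ∣
    adjacent    : {I J : Subset n} → ∣ _△_ G I J ∣ ≡ 1 → ∣ _△_ G′ (F I) (F J) ∣ ≡ 1

Reach-target-independent : {G : Graph n} {l : ℕ} {I K : Subset n} → Reach G l I K → IsIndependent G K
Reach-target-independent (here K-ind _)  = K-ind
Reach-target-independent (step _ _ _ r) = Reach-target-independent r

module _ {G : Graph n} {G′ : Graph m} {F : Subset n → Subset m} (φ : ReconfigurationMap G G′ F) where
  open ReconfigurationMap φ

  Reach-map : {l : ℕ} {I K : Subset n} → Reach G l I K → Reach G′ l (F I) (F K)
  Reach-map {l} (here I-ind l≤∣I∣)         = here (independent I-ind) (subst (l ≤_) (sym (size I-ind)) l≤∣I∣)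
  Reach-map {l} (step I-ind l≤∣I∣ I∼J r) =
    step (independent I-ind) (subst (l ≤_) (sym (size I-ind)) l≤∣I∣) (adjacent I∼J) (Reach-map r)

  YesInstance-map : {l s : ℕ} {I : Subset n} {I′ : Subset m} → F I ≡ I′ →
                    YesInstance G l I s → YesInstance G′ l I′ s
  YesInstance-map {s = s} refl (K , s≤∣K∣ , r) =
    F K , subst (s ≤_) (sym (size (Reach-target-independent r))) s≤∣K∣ , Reach-map r

insertAt-map : (G : Graph (suc m)) (b : Fin (suc m)) → ReconfigurationMap (delete G b) G (λ X → insertAt X b false)
insertAt-map G b = record
  { independent = insertAt-independent b G
  ; size        = λ {X} _ → ∣insertAt∣ b X
  ; adjacent    = λ {X} {Y} → subst (_≡ 1) (sym (∣insertAt-△∣ b X Y))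
  }

module _ (b c : Fin n) where

  -- As a polynomial over GF(2), move I = I + I(b)·(e_b + e_c): linear in I, and for an
  -- independent I containing b but not c it replaces b by c.
  move : Subset n → Subset n
  move I = tabulate λ v → lookup I v xor (lookup I b ∧ (lookup ⁅ b ⁆ v xor lookup ⁅ c ⁆ v))

  lookup-move : (I : Subset n) (v : Fin n) →
                lookup (move I) v ≡ lookup I v xor (lookup I b ∧ (lookup ⁅ b ⁆ v xor lookup ⁅ c ⁆ v))
  lookup-move I = lookup∘tabulate _

  move-fixes : {I : Subset n} → lookup I b ≡ false → move I ≡ I
  move-fixes {I} I[b] = lookup-ext λ v → begin
    lookup (move I) v                                                  ≡⟨ lookup-move I v ⟩
    lookup I v xor (lookup I b ∧ (lookup ⁅ b ⁆ v xor lookup ⁅ c ⁆ v)) ≡⟨ cong (λ x → lookup I v xor (x ∧ _)) I[b] ⟩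
    lookup I v xor false                                               ≡⟨ xor-identityʳ _ ⟩
    lookup I v                                                         ∎

  move-⁅⁆ : (w : Fin n) → ∃ λ w′ → move ⁅ w ⁆ ≡ ⁅ w′ ⁆
  move-⁅⁆ w with w ≟ b
  ... | no  w≢b  = w , move-fixes (lookup-⁅y⁆ (w≢b ∘ sym))
  ... | yes refl = c , lookup-ext λ v → begin
    lookup (move ⁅ b ⁆) v                                                   ≡⟨ lookup-move ⁅ b ⁆ v ⟩
    lookup ⁅ b ⁆ v xor (lookup ⁅ b ⁆ b ∧ (lookup ⁅ b ⁆ v xor lookup ⁅ c ⁆ v))
      ≡⟨ cong (λ x → lookup ⁅ b ⁆ v xor (x ∧ (lookup ⁅ b ⁆ v xor lookup ⁅ c ⁆ v))) (lookup-⁅x⁆ b) ⟩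
    lookup ⁅ b ⁆ v xor (lookup ⁅ b ⁆ v xor lookup ⁅ c ⁆ v)
      ≡⟨ sym (xor-assoc (lookup ⁅ b ⁆ v) (lookup ⁅ b ⁆ v) (lookup ⁅ c ⁆ v)) ⟩
    (lookup ⁅ b ⁆ v xor lookup ⁅ b ⁆ v) xor lookup ⁅ c ⁆ v
      ≡⟨ cong (_xor lookup ⁅ c ⁆ v) (xor-same (lookup ⁅ b ⁆ v)) ⟩
    lookup ⁅ c ⁆ v ∎

  move-△ : (I J : Subset n) → move ((I ─ J) ∪ (J ─ I)) ≡ (move I ─ move J) ∪ (move J ─ move I)
  move-△ I J = lookup-ext λ v →
    let x = lookup I v; y = lookup J v; t = lookup ⁅ b ⁆ v xor lookup ⁅ c ⁆ v in begin
    lookup (move ((I ─ J) ∪ (J ─ I))) v          ≡⟨ lookup-move ((I ─ J) ∪ (J ─ I)) v ⟩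
    lookup ((I ─ J) ∪ (J ─ I)) v xor (lookup ((I ─ J) ∪ (J ─ I)) b ∧ t)
                                                 ≡⟨ cong₂ (λ z z′ → z xor (z′ ∧ t)) (lookup-△ I J v) (lookup-△ I J b) ⟩
    (x xor y) xor ((lookup I b xor lookup J b) ∧ t) ≡⟨ cong ((x xor y) xor_) (∧-distribʳ-xor t (lookup I b) (lookup J b)) ⟩
    (x xor y) xor ((lookup I b ∧ t) xor (lookup J b ∧ t)) ≡⟨ interchange x y (lookup I b ∧ t) (lookup J b ∧ t) ⟩
    (x xor (lookup I b ∧ t)) xor (y xor (lookup J b ∧ t)) ≡⟨ sym (cong₂ _xor_ (lookup-move I v) (lookup-move J v)) ⟩
    lookup (move I) v xor lookup (move J) v      ≡⟨ sym (lookup-△ (move I) (move J) v) ⟩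
    lookup ((move I ─ move J) ∪ (move J ─ move I)) v ∎

  ∣move-△∣ : {I J : Subset n} → ∣ (I ─ J) ∪ (J ─ I) ∣ ≡ 1 → ∣ (move I ─ move J) ∪ (move J ─ move I) ∣ ≡ 1
  ∣move-△∣ {I} {J} I∼J with ∣p∣≡1⇒p≡⁅x⁆ ((I ─ J) ∪ (J ─ I)) I∼J
  ... | w , I△J≡⁅w⁆ with move-⁅⁆ w
  ... | w′ , move⁅w⁆≡⁅w′⁆ = begin
    ∣ (move I ─ move J) ∪ (move J ─ move I) ∣ ≡⟨ cong ∣_∣ (sym (move-△ I J)) ⟩
    ∣ move ((I ─ J) ∪ (J ─ I)) ∣              ≡⟨ cong (∣_∣ ∘ move) I△J≡⁅w⁆ ⟩
    ∣ move ⁅ w ⁆ ∣                            ≡⟨ cong ∣_∣ move⁅w⁆≡⁅w′⁆ ⟩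
    ∣ ⁅ w′ ⁆ ∣                                ≡⟨ ∣⁅x⁆∣≡1 w′ ⟩
    1                                         ∎

  module _ (b≢c : b ≢ c) where

    lookup-move-b : (I : Subset n) → lookup (move I) b ≡ false
    lookup-move-b I = begin
      lookup (move I) b                                                  ≡⟨ lookup-move I b ⟩
      lookup I b xor (lookup I b ∧ (lookup ⁅ b ⁆ b xor lookup ⁅ c ⁆ b)) ≡⟨ cong (λ t → lookup I b xor (lookup I b ∧ t))
                                                                             (cong₂ _xor_ (lookup-⁅x⁆ b) (lookup-⁅y⁆ b≢c)) ⟩
      lookup I b xor (lookup I b ∧ true)                                 ≡⟨ cong (lookup I b xor_) (∧-identityʳ (lookup I b)) ⟩
      lookup I b xor lookup I b                                          ≡⟨ xor-same (lookup I b) ⟩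
      false                                                              ∎

    lookup-move-c : (I : Subset n) → lookup (move I) c ≡ lookup I c xor lookup I b
    lookup-move-c I = begin
      lookup (move I) c                                                  ≡⟨ lookup-move I c ⟩
      lookup I c xor (lookup I b ∧ (lookup ⁅ b ⁆ c xor lookup ⁅ c ⁆ c)) ≡⟨ cong (λ t → lookup I c xor (lookup I b ∧ t))
                                                                             (cong₂ _xor_ (lookup-⁅y⁆ (b≢c ∘ sym)) (lookup-⁅x⁆ c)) ⟩
      lookup I c xor (lookup I b ∧ true)                                 ≡⟨ cong (lookup I c xor_) (∧-identityʳ (lookup I b)) ⟩
      lookup I c xor lookup I b                                          ∎

    lookup-move-other : (I : Subset n) {v : Fin n} → v ≢ b → v ≢ c → lookup (move I) v ≡ lookup I v
    lookup-move-other I {v} v≢b v≢c = begin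
      lookup (move I) v                                                  ≡⟨ lookup-move I v ⟩
      lookup I v xor (lookup I b ∧ (lookup ⁅ b ⁆ v xor lookup ⁅ c ⁆ v)) ≡⟨ cong (λ t → lookup I v xor (lookup I b ∧ t))
                                                                             (cong₂ _xor_ (lookup-⁅y⁆ v≢b) (lookup-⁅y⁆ v≢c)) ⟩
      lookup I v xor (lookup I b ∧ false)                                ≡⟨ cong (lookup I v xor_) (∧-zeroʳ (lookup I b)) ⟩
      lookup I v xor false                                               ≡⟨ xor-identityʳ (lookup I v) ⟩
      lookup I v                                                         ∎

    ∈-move : {I : Subset n} {u : Fin n} → u ∈ move I → (u ∈ I × u ≢ b) ⊎ (u ≡ c × b ∈ I)
    ∈-move {I} {u} u∈ with u ≟ b | u ≟ c
    ... | yes refl | _        = contradiction (trans (sym ([]=⇒lookup u∈)) (lookup-move-b I)) λ ()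
    ... | no  u≢b  | no  u≢c = inj₁ (lookup⇒[]= u I (trans (sym (lookup-move-other I u≢b u≢c)) ([]=⇒lookup u∈)) , u≢b)
    ... | no  u≢b  | yes refl with xor≡true (lookup I c) (lookup I b) (trans (sym (lookup-move-c I)) ([]=⇒lookup u∈))
    ...   | inj₁ I[c] = inj₁ (lookup⇒[]= c I I[c] , u≢b)
    ...   | inj₂ I[b] = inj₂ (refl , lookup⇒[]= b I I[b])

lookup-N[] : (G : Graph n) (v u : Fin n) → lookup (N[_] G v) u ≡ adj G v u ∨ lookup ⁅ v ⁆ u
lookup-N[] G v u = trans (lookup-zipWith _∨_ u (N G v) ⁅ v ⁆) (cong (_∨ lookup ⁅ v ⁆ u) (lookup∘tabulate (adj G v) u))

module Twins (G : Graph (suc m)) {b c : Fin (suc m)} (b≢c : b ≢ c) (N[b]≡N[c] : N[_] G b ≡ N[_] G c) where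

  private
    closed : (u : Fin (suc m)) → adj G b u ∨ lookup ⁅ b ⁆ u ≡ adj G c u ∨ lookup ⁅ c ⁆ u
    closed u = trans (sym (lookup-N[] G b u)) (trans (cong (λ X → lookup X u) N[b]≡N[c]) (lookup-N[] G c u))

  twins-adjacent : adj G b c ≡ true
  twins-adjacent = begin
    adj G b c                       ≡⟨ sym (∨-identityʳ (adj G b c)) ⟩
    adj G b c ∨ false               ≡⟨ cong (adj G b c ∨_) (sym (lookup-⁅y⁆ (b≢c ∘ sym))) ⟩
    adj G b c ∨ lookup ⁅ b ⁆ c      ≡⟨ closed c ⟩
    adj G c c ∨ lookup ⁅ c ⁆ c      ≡⟨ cong₂ _∨_ (irrefl G c) (lookup-⁅x⁆ c) ⟩
    true                            ∎

  twins-agree : {u : Fin (suc m)} → u ≢ b → u ≢ c → adj G b u ≡ adj G c u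
  twins-agree {u} u≢b u≢c = begin
    adj G b u                       ≡⟨ sym (∨-identityʳ (adj G b u)) ⟩
    adj G b u ∨ false               ≡⟨ cong (adj G b u ∨_) (sym (lookup-⁅y⁆ u≢b)) ⟩
    adj G b u ∨ lookup ⁅ b ⁆ u      ≡⟨ closed u ⟩
    adj G c u ∨ lookup ⁅ c ⁆ u      ≡⟨ cong (adj G c u ∨_) (lookup-⁅y⁆ u≢c) ⟩
    adj G c u ∨ false               ≡⟨ ∨-identityʳ (adj G c u) ⟩
    adj G c u                       ∎

  module _ {I : Subset (suc m)} (I-ind : IsIndependent G I) where

    twin-nonadjacent : {u : Fin (suc m)} → b ∈ I → u ∈ I → u ≢ b → adj G c u ≡ false
    twin-nonadjacent {u} b∈I u∈I u≢b with u ≟ c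
    ... | yes refl = irrefl G c
    ... | no  u≢c  = trans (sym (twins-agree u≢b u≢c)) (I-ind b u b∈I u∈I)

    move-independent : IsIndependent G (move b c I)
    move-independent u v u∈ v∈ with ∈-move b c b≢c u∈ | ∈-move b c b≢c v∈
    ... | inj₁ (u∈I , _)    | inj₁ (v∈I , _)    = I-ind u v u∈I v∈I
    ... | inj₁ (u∈I , u≢b)  | inj₂ (refl , b∈I) = trans (Graph.sym G u c) (twin-nonadjacent b∈I u∈I u≢b)
    ... | inj₂ (refl , b∈I) | inj₁ (v∈I , v≢b)  = twin-nonadjacent b∈I v∈I v≢b
    ... | inj₂ (refl , _)   | inj₂ (refl , _)   = irrefl G c

    ∣move∣ : ∣ move b c I ∣ ≡ ∣ I ∣
    ∣move∣ with b ∈? I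
    ... | no  b∉I = cong ∣_∣ (move-fixes b c {I} (∉⇒lookup≡false b∉I))
    ... | yes b∈I = begin
      ∣ move b c I ∣
        ≡⟨ ∣p∣≡suc∣q∣ (move b c I) (I [ b ]≔ false) c moved[c] (trans (lookup∘update′ (b≢c ∘ sym) I false) I[c]) agree ⟩
      suc ∣ I [ b ]≔ false ∣
        ≡⟨ sym (∣p∣≡suc∣q∣ I (I [ b ]≔ false) b I[b] (lookup∘update b I false) λ v v≢b → sym (lookup∘update′ v≢b I false)) ⟩
      ∣ I ∣ ∎
      where
      I[b] : lookup I b ≡ true
      I[b] = []=⇒lookup b∈I

      I[c] : lookup I c ≡ false
      I[c] with lookup I c in I[c]
      ... | false = refl
      ... | true  = contradiction (trans (sym twins-adjacent) (I-ind b c b∈I (lookup⇒[]= c I I[c]))) λ ()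

      moved[c] : lookup (move b c I) c ≡ true
      moved[c] = trans (lookup-move-c b c b≢c I) (cong₂ _xor_ I[c] I[b])

      agree : ∀ v → v ≢ c → lookup (move b c I) v ≡ lookup (I [ b ]≔ false) v
      agree v v≢c with v ≟ b
      ... | yes refl = trans (lookup-move-b b c b≢c I) (sym (lookup∘update b I false))
      ... | no  v≢b  = trans (lookup-move-other b c b≢c I v≢b v≢c) (sym (lookup∘update′ v≢b I false))

  restrict-move-map : ReconfigurationMap G (delete G b) (restrict b ∘ move b c)
  restrict-move-map = record
    { independent = λ I-ind → restrict-independent b G (move-independent I-ind)
    ; size        = λ {I} I-ind → trans (∣restrict∣ b (move b c I) (lookup-move-b b c b≢c I)) (∣move∣ I-ind)
    ; adjacent    = λ {I} {J} I∼J →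
        trans (∣restrict-△∣ b (move b c I) (move b c J) (trans (lookup-move-b b c b≢c I) (sym (lookup-move-b b c b≢c J))))
              (∣move-△∣ b c {I} {J} I∼J)
    }

lemma5 : ∀ {m : ℕ} (G : Graph (suc m)) (d l s : ℕ) (Iini : Subset (suc m))
           (bi bj : Fin (suc m)) →
           Degenerate G d → ∣ Iini ∣ < s →
           bi ≢ bj → InD' G d Iini bi → InD' G d Iini bj →
           N[_] G bi ≡ N[_] G bj →
           YesInstance G l Iini s ⇔ YesInstance (delete G bi) l (restrict bi Iini) s
lemma5 G d l s Iini bi bj _ _ bi≢bj (_ , bi∉Iini) _ N[bi]≡N[bj] = mk⇔
  (YesInstance-map (Twins.restrict-move-map G bi≢bj N[bi]≡N[bj]) (cong (restrict bi) (move-fixes bi bj {Iini} Iini[bi])))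
  (YesInstance-map (insertAt-map G bi) (insertAt-restrict bi Iini[bi]))
  where
  Iini[bi] : lookup Iini bi ≡ false
  Iini[bi] = ∉⇒lookup≡false bi∉Iini
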